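{- The set $\widehat{\Lambda}$ is exactly the set of typable modal $\lambda$-terms in $\beta\eta\kappa$-normal form, i.e. the set of terms $M\in\Lambda$ such that there is no $N$ with $M\rightsquigarrow_{\beta\eta\kappa}N$.
   Context: Types: $A ::= a \mid (A\to A) \mid \Box A$ ($a$ atoms); $(A_1,\ldots,A_n)\to C$ abbreviates $A_1\to(\cdots\to(A_n\to C)\cdots)$. Modal $\lambda$-terms: $M,N ::= x \mid \lambda x.M \mid MN \mid M[N_1,\ldots,N_n/x_1,\ldots,x_n]$ (explicit substitution; $x_1,\ldots,x_n$ distinct and bound in $M$), modulo $\alpha$-equivalence and simultaneous permutation of the pairs $N_i/x_i$. Vectors $\vec P$ abbreviate lists. $FV(x)=\{x\}$, $FV(\lambda x.N)=FV(N)\setminus\{x\}$, $FV(NP)=FV(N)\cup FV(P)$, $FV(N[\vec P/\vec x])=\bigcup_i FV(P_i)$; $M\{N/x\}$ is capture-avoiding substitution. System $\mathsf{ND}_{\mathsf{CK}}$ (contexts = lists of declarations $x:A$ with distinct variables): (Id) $x_1:A_1,\ldots,x_n:A_n\vdash x_i:A_i$; (Abs) from $\Gamma,x:A\vdash M:C$ infer $\Gamma\vdash\lambda x.M:A\to C$; (App) from $\Gamma\vdash N:A$ and $\Gamma\vdash M:A\to C$ infer $\Gamma\vdash MN:C$; ($\Box$-subst) from $\Gamma\vdash N_i:\Box A_i$ ($i=1..n$) and $x_1:A_1,\ldots,x_n:A_n\vdash M:C$ infer $\Gamma\vdash M[N_1,\ldots,N_n/x_1,\ldots,x_n]:\Box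 C$, $x_i$ not in $\Gamma$. $\Lambda$: terms with a derivable type assignment; $\Lambda^\lambda$, $\Lambda^\Box$: its $\lambda$-abstractions, explicit substitutions. Reduction $\rightsquigarrow_{\beta\eta\kappa}$: ground steps ($\beta_1$) $(\lambda x.M)N \to M\{N/x\}$; ($\beta_2$) $M[\vec P, R[\vec N/\vec z], \vec Q/\vec x, y, \vec w] \to (M\{R/y\})[\vec P,\vec N,\vec Q/\vec x,\vec z,\vec w]$; ($\eta_1$) $M\to \lambda x.Mx$ if $\Gamma\vdash M:A\to B$ derivable, $x\notin FV(M)$, $M\notin\Lambda^\lambda$; ($\eta_2$) $M\to x[M/x]$ if $\Gamma\vdash M:\Box A$ derivable, $x\notin FV(M)$, $M\notin\Lambda^\Box$; ($\kappa_1$) $M[\vec P,N,\vec Q/\vec x,y,\vec z]\to M[\vec P,\vec Q/\vec x,\vec z]$ if $y$ has no free occurrence in $M$; ($\kappa_2$) $M[\vec P,N,N,\vec Q/\vec x,y_1,y_2,\vec z]\to (M\{v,v/y_1,y_2\})[\vec P,N,\vec Q/\vec x,v,\vec z]$, $v$ fresh. Terms with a hole: $\mathsf C ::= \circ \mid \lambda x.\mathsf C \mid M\mathsf C \mid \mathsf C M \mid \mathsf C[\vec M/\vec x] \mid M[\vec N_1,\mathsf C,\vec N_2/\vec x_1,x,\vec x_2]$; $\mathsf E ::= \circ \mid \lambda x.\mathsf E \mid M\mathsf E \mid \mathsf E' M \mid \mathsf E[\vec M/\vec x] \mid M[\vec N_1,\mathsf E,\vec N_2/\vec x_1,x,\vec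 x_2]$ with $\mathsf E'\neq\circ$; $\mathsf D ::= \circ \mid \lambda x.\mathsf D \mid M\mathsf D \mid \mathsf D M \mid \mathsf D[\vec M/\vec x] \mid M[\vec N_1,\mathsf D',\vec N_2/\vec x_1,x,\vec x_2]$ with $\mathsf D'\neq\circ$. $\beta$- and $\kappa$-steps close under all $\mathsf C$, $\eta_1$-steps under $\mathsf E$, $\eta_2$-steps under $\mathsf D$ (a step $M\to N$ yields $\mathsf C\langle M\rangle\rightsquigarrow\mathsf C\langle N\rangle$, where $\mathsf C\langle M\rangle$ replaces $\circ$ by $M$). $\widehat{\Lambda}$ is defined inductively: (i) if $x$ is a variable, $T_1,\ldots,T_n\in\widehat\Lambda$, and $\Gamma\vdash x:(A_1,\ldots,A_n)\to C$ with $C$ atomic and $\Gamma\vdash T_i:A_i$ ($i=1..n$) are derivable, then $xT_1\cdots T_n\in\widehat\Lambda$ (variables being the case $n=0$); (ii) if $T\in\widehat\Lambda$ and $\Gamma,x:A\vdash T:C$ is derivable, then $\lambda x.T\in\widehat\Lambda$; (iii) if $M\in\widehat\Lambda$ with $FV(M)=\{x_1,\ldots,x_n\}$, $x_1:B_1,\ldots,x_n:B_n\vdash M:C$ is derivable, and $T_1,\ldots,T_n$ are $n$ distinct terms of the form $T_i=y_iU_{i1}\cdots U_{ik_i}$ with all $U_{ij}\in\widehat\Lambda$ such that $\Gamma\vdash T_i:\Box B_i$ is derivable for all $i$, then $M[T_1,\ldots,T_n/x_1,\ldots,x_n]\in\widehat\Lambda$. -}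

module Defs where

open import Data.Nat using (ℕ)
open import Data.Bool using (Bool; true; false)
open import Data.List using (List; []; _∷_; _++_)
open import Data.Sum using (_⊎_; inj₁; inj₂)
open import Data.Product using (Σ; _×_; _,_; ∃)
open import Relation.Nullary using (¬_)
open import Data.Unit using (⊤)
open import Data.Empty using (⊥)
open import Relation.Binary.PropositionalEquality using (_≡_; _≢_)

infixr 7 _⇒_
data Ty : Set where
  atom : ℕ → Ty
  _⇒_  : Ty → Ty → Ty
  □    : Ty → Ty

Ctx : Set
Ctx = List Ty

infix 4 _∋_
data _∋_ : Ctx → Ty → Set where
  here  : ∀ {Γ A} → (A ∷ Γ) ∋ A
  there : ∀ {Γ A B} → Γ ∋ A → (B ∷ Γ) ∋ A

variable
  Γ Δ Ξ ΔP ΔQ : Ctx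
  A B C : Ty
  a : ℕ
  b : Bool

-- Typed terms (= type derivations of ND_CK).
-- sub M σ  is  M[N₁,…,Nₙ/x₁,…,xₙ] where M : Tm Δ C, Δ = A₁,…,Aₙ
-- (x_i = i-th variable of Δ) and σ = N₁ ∷ … ∷ Nₙ with N_i : Tm Γ (□ A_i).

mutual
  data Tm (Γ : Ctx) : Ty → Set where
    var : Γ ∋ A → Tm Γ A
    lam : Tm (A ∷ Γ) C → Tm Γ (A ⇒ C)
    app : Tm Γ (A ⇒ C) → Tm Γ A → Tm Γ C
    sub : Tm Δ C → Subs Γ Δ → Tm Γ (□ C)

  data Subs (Γ : Ctx) : Ctx → Set where
    []  : Subs Γ []
    _∷_ : Tm Γ (□ A) → Subs Γ Δ → Subs Γ (A ∷ Δ)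

infixr 5 _++ˢ_
_++ˢ_ : Subs Γ Δ → Subs Γ Ξ → Subs Γ (Δ ++ Ξ)
[] ++ˢ τ = τ
(N ∷ σ) ++ˢ τ = N ∷ (σ ++ˢ τ)

lookupˢ : Subs Γ Δ → Δ ∋ A → Tm Γ (□ A)
lookupˢ (N ∷ σ) here = N
lookupˢ (N ∷ σ) (there p) = lookupˢ σ p

Ren : Ctx → Ctx → Set
Ren Γ Δ = ∀ {A} → Γ ∋ A → Δ ∋ A

ext : Ren Γ Δ → Ren (A ∷ Γ) (A ∷ Δ)
ext ρ here = here
ext ρ (there p) = there (ρ p)

mutual
  rename : Ren Γ Δ → Tm Γ A → Tm Δ A
  rename ρ (var p) = var (ρ p)
  rename ρ (lam M) = lam (rename (ext ρ) M)
  rename ρ (app M N) = app (rename ρ M) (rename ρ N)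
  rename ρ (sub M σ) = sub M (renameˢ ρ σ)

  renameˢ : Ren Γ Δ → Subs Γ Ξ → Subs Δ Ξ
  renameˢ ρ [] = []
  renameˢ ρ (N ∷ σ) = rename ρ N ∷ renameˢ ρ σ

Sb : Ctx → Ctx → Set
Sb Γ Δ = ∀ {A} → Γ ∋ A → Tm Δ A

exts : Sb Γ Δ → Sb (A ∷ Γ) (A ∷ Δ)
exts s here = var here
exts s (there p) = rename there (s p)

mutual
  subst : Sb Γ Δ → Tm Γ A → Tm Δ A
  subst s (var p) = s p
  subst s (lam M) = lam (subst (exts s) M)
  subst s (app M N) = app (subst s M) (subst s N)
  subst s (sub M σ) = sub M (substˢ s σ)

  substˢ : Sb Γ Δ → Subs Γ Ξ → Subs Δ Ξ
  substˢ s [] = []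
  substˢ s (N ∷ σ) = subst s N ∷ substˢ s σ

single : Tm Γ A → Sb (A ∷ Γ) Γ
single N here = N
single N (there p) = var p

_[_]₀ : Tm (A ∷ Γ) C → Tm Γ A → Tm Γ C
M [ N ]₀ = subst (single N) M

inl : Γ ∋ A → (Γ ++ Δ) ∋ A
inl here = here
inl (there p) = there (inl p)

inr : (Γ : Ctx) → Δ ∋ A → (Γ ++ Δ) ∋ A
inr [] p = p
inr (B ∷ Γ) p = there (inr Γ p)

split : (Γ : Ctx) → (Γ ++ Δ) ∋ A → (Γ ∋ A) ⊎ (Δ ∋ A)
split [] p = inj₂ p
split (B ∷ Γ) here = inj₁ here
split (B ∷ Γ) (there p) with split Γ p
... | inj₁ q = inj₁ (there q)
... | inj₂ q = inj₂ q

wkAt : (ΔP : Ctx) → Ren (ΔP ++ ΔQ) (ΔP ++ B ∷ ΔQ)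
wkAt ΔP p with split ΔP p
... | inj₁ q = inl q
... | inj₂ q = inr ΔP (there q)

mergeAt : (ΔP : Ctx) → Ren (ΔP ++ A ∷ A ∷ ΔQ) (ΔP ++ A ∷ ΔQ)
mergeAt ΔP p with split ΔP p
... | inj₁ q = inl q
... | inj₂ here = inr ΔP here
... | inj₂ (there here) = inr ΔP here
... | inj₂ (there (there q)) = inr ΔP (there q)

swapAt : (ΔP : Ctx) → Ren (ΔP ++ A ∷ B ∷ ΔQ) (ΔP ++ B ∷ A ∷ ΔQ)
swapAt ΔP p with split ΔP p
... | inj₁ q = inl q
... | inj₂ here = inr ΔP (there here)
... | inj₂ (there here) = inr ΔP here
... | inj₂ (there (there q)) = inr ΔP (there (there q))

β₂Sb : (ΔP : Ctx) → Tm Ξ B → Sb (ΔP ++ B ∷ ΔQ) (ΔP ++ (Ξ ++ ΔQ))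
β₂Sb ΔP R p with split ΔP p
... | inj₁ q = var (inl q)
... | inj₂ here = rename (λ q → inr ΔP (inl q)) R
... | inj₂ (there q) = var (inr ΔP (inr _ q))

-- Equivalence of terms: congruence generated by simultaneous permutation
-- of the pairs N_i/x_i of an explicit substitution (α is built in).

infix 4 _≈_ _≈ˢ_
mutual
  data _≈_ {Γ : Ctx} : {A : Ty} → Tm Γ A → Tm Γ A → Set where
    ≈-refl  : {M : Tm Γ A} → M ≈ M
    ≈-sym   : {M N : Tm Γ A} → M ≈ N → N ≈ M
    ≈-trans : {M N P : Tm Γ A} → M ≈ N → N ≈ P → M ≈ P
    ≈-lam   : {M M' : Tm (A ∷ Γ) C} → M ≈ M' → lam M ≈ lam M'
    ≈-app   : {M M' : Tm Γ (A ⇒ C)} {N N' : Tm Γ A} →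
              M ≈ M' → N ≈ N' → app M N ≈ app M' N'
    ≈-sub   : {M M' : Tm Δ C} {σ σ' : Subs Γ Δ} →
              M ≈ M' → σ ≈ˢ σ' → sub M σ ≈ sub M' σ'
    ≈-swap  : (ΔP : Ctx) {M : Tm (ΔP ++ A ∷ B ∷ ΔQ) C} {σP : Subs Γ ΔP}
              {N₁ : Tm Γ (□ A)} {N₂ : Tm Γ (□ B)} {σQ : Subs Γ ΔQ} →
              sub M (σP ++ˢ (N₁ ∷ N₂ ∷ σQ))
                ≈ sub (rename (swapAt ΔP) M) (σP ++ˢ (N₂ ∷ N₁ ∷ σQ))

  data _≈ˢ_ {Γ : Ctx} : {Δ : Ctx} → Subs Γ Δ → Subs Γ Δ → Set where
    []  : [] ≈ˢ []
    _∷_ : {N N' : Tm Γ (□ A)} {σ σ' : Subs Γ Δ} →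
          N ≈ N' → σ ≈ˢ σ' → (N ∷ σ) ≈ˢ (N' ∷ σ')

IsLam : Tm Γ A → Set
IsLam (lam _) = ⊤
IsLam _ = ⊥

IsSub : Tm Γ A → Set
IsSub (sub _ _) = ⊤
IsSub _ = ⊥

η₁-exp : Tm Γ (A ⇒ B) → Tm Γ (A ⇒ B)
η₁-exp M = lam (app (rename there M) (var here))

η₂-exp : Tm Γ (□ A) → Tm Γ (□ A)
η₂-exp M = sub (var here) (M ∷ [])

-- β₁, β₂, κ₁, κ₂ (positions of the pairs arbitrary: P⃗ = σP, Q⃗ = σQ).
-- κ₁: "y has no free occurrence in M" is expressed as M being the
-- weakening of some M' not mentioning y.
data Ground {Γ : Ctx} : {A : Ty} → Tm Γ A → Tm Γ A → Set where
  β₁ : (M : Tm (A ∷ Γ) C) (N : Tm Γ A) → Ground (app (lam M) N) (M [ N ]₀)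
  β₂ : (ΔP : Ctx) (M : Tm (ΔP ++ B ∷ ΔQ) C) (σP : Subs Γ ΔP)
       (R : Tm Ξ B) (τ : Subs Γ Ξ) (σQ : Subs Γ ΔQ) →
       Ground (sub M (σP ++ˢ (sub R τ ∷ σQ)))
              (sub (subst (β₂Sb ΔP R) M) (σP ++ˢ (τ ++ˢ σQ)))
  κ₁ : (ΔP : Ctx) (M : Tm (ΔP ++ ΔQ) C) (σP : Subs Γ ΔP)
       (N : Tm Γ (□ B)) (σQ : Subs Γ ΔQ) →
       Ground (sub (rename (wkAt ΔP) M) (σP ++ˢ (N ∷ σQ))) (sub M (σP ++ˢ σQ))
  κ₂ : (ΔP : Ctx) (M : Tm (ΔP ++ A ∷ A ∷ ΔQ) C) (σP : Subs Γ ΔP)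
       (N : Tm Γ (□ A)) (σQ : Subs Γ ΔQ) →
       Ground (sub M (σP ++ˢ (N ∷ N ∷ σQ)))
              (sub (rename (mergeAt ΔP) M) (σP ++ˢ (N ∷ σQ)))

mutual
  data _⟶βκ_ {Γ : Ctx} : {A : Ty} → Tm Γ A → Tm Γ A → Set where
    ground : {M N : Tm Γ A} → Ground M N → M ⟶βκ N
    c-lam  : {M M' : Tm (A ∷ Γ) C} → M ⟶βκ M' → lam M ⟶βκ lam M'
    c-appL : {M M' : Tm Γ (A ⇒ C)} {N : Tm Γ A} → M ⟶βκ M' → app M N ⟶βκ app M' N
    c-appR : {M : Tm Γ (A ⇒ C)} {N N' : Tm Γ A} → N ⟶βκ N' → app M N ⟶βκ app M N'
    c-subB : {M M' : Tm Δ C} {σ : Subs Γ Δ} → M ⟶βκ M' → sub M σ ⟶βκ sub M' σ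
    c-subA : {M : Tm Δ C} {σ σ' : Subs Γ Δ} → σ ⟶βκˢ σ' → sub M σ ⟶βκ sub M σ'

  data _⟶βκˢ_ {Γ : Ctx} : {Δ : Ctx} → Subs Γ Δ → Subs Γ Δ → Set where
    hd : {N N' : Tm Γ (□ A)} {σ : Subs Γ Δ} → N ⟶βκ N' → (N ∷ σ) ⟶βκˢ (N' ∷ σ)
    tl : {N : Tm Γ (□ A)} {σ σ' : Subs Γ Δ} → σ ⟶βκˢ σ' → (N ∷ σ) ⟶βκˢ (N ∷ σ')

-- η₁: contexts E.  The Bool index records whether the step is at the
-- root (hole = ∘); in  E' M  the context E' must not be ∘.
mutual
  data η₁⟨_⟩ {Γ : Ctx} : Bool → {A : Ty} → Tm Γ A → Tm Γ A → Set where
    e-top  : {M : Tm Γ (A ⇒ B)} → ¬ IsLam M → η₁⟨ true ⟩ M (η₁-exp M)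
    e-lam  : {M M' : Tm (A ∷ Γ) C} → η₁⟨ b ⟩ M M' → η₁⟨ false ⟩ (lam M) (lam M')
    e-appL : {M M' : Tm Γ (A ⇒ C)} {N : Tm Γ A} →
             η₁⟨ false ⟩ M M' → η₁⟨ false ⟩ (app M N) (app M' N)
    e-appR : {M : Tm Γ (A ⇒ C)} {N N' : Tm Γ A} →
             η₁⟨ b ⟩ N N' → η₁⟨ false ⟩ (app M N) (app M N')
    e-subB : {M M' : Tm Δ C} {σ : Subs Γ Δ} →
             η₁⟨ b ⟩ M M' → η₁⟨ false ⟩ (sub M σ) (sub M' σ)
    e-subA : {M : Tm Δ C} {σ σ' : Subs Γ Δ} →
             η₁ˢ σ σ' → η₁⟨ false ⟩ (sub M σ) (sub M σ')

  data η₁ˢ {Γ : Ctx} : {Δ : Ctx} → Subs Γ Δ → Subs Γ Δ → Set where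
    hd : {N N' : Tm Γ (□ A)} {σ : Subs Γ Δ} → η₁⟨ b ⟩ N N' → η₁ˢ (N ∷ σ) (N' ∷ σ)
    tl : {N : Tm Γ (□ A)} {σ σ' : Subs Γ Δ} → η₁ˢ σ σ' → η₁ˢ (N ∷ σ) (N ∷ σ')

-- η₂: contexts D.  Inside an argument of an explicit substitution the
-- context D' must not be ∘.
mutual
  data η₂⟨_⟩ {Γ : Ctx} : Bool → {A : Ty} → Tm Γ A → Tm Γ A → Set where
    d-top  : {M : Tm Γ (□ A)} → ¬ IsSub M → η₂⟨ true ⟩ M (η₂-exp M)
    d-lam  : {M M' : Tm (A ∷ Γ) C} → η₂⟨ b ⟩ M M' → η₂⟨ false ⟩ (lam M) (lam M')
    d-appL : {M M' : Tm Γ (A ⇒ C)} {N : Tm Γ A} →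
             η₂⟨ b ⟩ M M' → η₂⟨ false ⟩ (app M N) (app M' N)
    d-appR : {M : Tm Γ (A ⇒ C)} {N N' : Tm Γ A} →
             η₂⟨ b ⟩ N N' → η₂⟨ false ⟩ (app M N) (app M N')
    d-subB : {M M' : Tm Δ C} {σ : Subs Γ Δ} →
             η₂⟨ b ⟩ M M' → η₂⟨ false ⟩ (sub M σ) (sub M' σ)
    d-subA : {M : Tm Δ C} {σ σ' : Subs Γ Δ} →
             η₂ˢ σ σ' → η₂⟨ false ⟩ (sub M σ) (sub M σ')

  data η₂ˢ {Γ : Ctx} : {Δ : Ctx} → Subs Γ Δ → Subs Γ Δ → Set where
    hd : {N N' : Tm Γ (□ A)} {σ : Subs Γ Δ} → η₂⟨ false ⟩ N N' → η₂ˢ (N ∷ σ) (N' ∷ σ)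
    tl : {N : Tm Γ (□ A)} {σ σ' : Subs Γ Δ} → η₂ˢ σ σ' → η₂ˢ (N ∷ σ) (N ∷ σ')

data Step {Γ : Ctx} {A : Ty} (M N : Tm Γ A) : Set where
  βκ : M ⟶βκ N → Step M N
  η₁ : ∀ {b} → η₁⟨ b ⟩ M N → Step M N
  η₂ : ∀ {b} → η₂⟨ b ⟩ M N → Step M N

infix 4 _⇝_
_⇝_ : Tm Γ A → Tm Γ A → Set
M ⇝ N = Σ _ λ M' → (M ≈ M') × Step M' N

Normal : Tm Γ A → Set
Normal {Γ} {A} M = ¬ (Σ (Tm Γ A) λ N → M ⇝ N)

mutual
  data Occurs {Γ : Ctx} {A : Ty} (p : Γ ∋ A) : {B : Ty} → Tm Γ B → Set where
    o-var  : Occurs p (var p)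
    o-lam  : {M : Tm (C ∷ Γ) B} → Occurs (there p) M → Occurs p (lam M)
    o-appL : {M : Tm Γ (C ⇒ B)} {N : Tm Γ C} → Occurs p M → Occurs p (app M N)
    o-appR : {M : Tm Γ (C ⇒ B)} {N : Tm Γ C} → Occurs p N → Occurs p (app M N)
    o-sub  : {M : Tm Δ B} {σ : Subs Γ Δ} → Occursˢ p σ → Occurs p (sub M σ)

  data Occursˢ {Γ : Ctx} {A : Ty} (p : Γ ∋ A) : {Δ : Ctx} → Subs Γ Δ → Set where
    hd : {N : Tm Γ (□ B)} {σ : Subs Γ Δ} → Occurs p N → Occursˢ p (N ∷ σ)
    tl : {N : Tm Γ (□ B)} {σ : Subs Γ Δ} → Occursˢ p σ → Occursˢ p (N ∷ σ)

Distinct : Subs Γ Δ → Set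
Distinct {Δ = Δ} σ = ∀ {A} (p q : Δ ∋ A) → p ≢ q → ¬ (lookupˢ σ p ≈ lookupˢ σ q)

mutual
  data Hat {Γ : Ctx} : {A : Ty} → Tm Γ A → Set where
    h-ne  : {t : Tm Γ (atom a)} → Spine t → Hat t
    h-lam : {T : Tm (A ∷ Γ) C} → Hat T → Hat (lam T)
    h-sub : {M : Tm Δ C} {σ : Subs Γ Δ} →
            Hat M →
            (∀ {B} (p : Δ ∋ B) → Occurs p M) →
            (∀ {B} (p : Δ ∋ B) → Spine (lookupˢ σ p)) →
            Distinct σ →
            Hat (sub M σ)

  data Spine {Γ : Ctx} : {A : Ty} → Tm Γ A → Set where
    s-var : (p : Γ ∋ A) → Spine (var p)
    s-app : {s : Tm Γ (A ⇒ C)} {U : Tm Γ A} → Spine s → Hat U → Spine (app s U)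

-- A term of Λ̂ has no redex: spines have a variable head (no β₁, no η₁ in
-- head position), the arguments of an explicit substitution are spines
-- (no β₂, no η₂ there), every substituted variable occurs (no κ₁) and the
-- arguments are pairwise distinct (no κ₂); as Λ̂ is closed under permuting
-- substitution pairs, this holds for every representative.  Conversely, in a
-- normal term each clause of Λ̂ holds because its failure exhibits a redex: a
-- variable or application of non-atomic type is η-expandable, an unused
-- substituted variable gives κ₁, an argument that is itself an explicit
-- substitution gives β₂, and two equal arguments can be permuted next to
-- each other to give κ₂.

module Submission where

open import Defs
open import Data.Bool using (false)
open import Data.Empty using (⊥-elim)
open import Data.List using ([]; _∷_; _++_)
open import Data.List.Properties using (++-assoc)
open import Data.Product using (Σ; _,_)
open import Data.Sum using (_⊎_; inj₁; inj₂; [_,_]′)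
open import Data.Unit using (tt)
open import Function.Base using (id)
open import Function.Bundles using (_⇔_; mk⇔; Equivalence)
open import Function.Construct.Identity using (⇔-id)
open import Function.Construct.Symmetry using (⇔-sym)
open import Function.Construct.Composition using (_⇔-∘_)
open import Relation.Nullary using (¬_)
open import Relation.Binary.PropositionalEquality
  using (_≡_; _≢_; refl; sym; trans; cong; cong₂; subst₂)
  renaming (subst to ≡-subst)

open Equivalence using (to; from)

data SplitView (ΔP : Ctx) {Δ : Ctx} {A : Ty} : (ΔP ++ Δ) ∋ A → Set where
  left  : (q : ΔP ∋ A) → SplitView ΔP (inl q)
  right : (q : Δ ∋ A) → SplitView ΔP (inr ΔP q)

splitView : (ΔP : Ctx) (p : (ΔP ++ Δ) ∋ A) → SplitView ΔP p
splitView [] p = right p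
splitView (B ∷ ΔP) here = left here
splitView (B ∷ ΔP) (there p) with splitView ΔP p
... | left q = left (there q)
... | right q = right q

split-inl : (ΔP : Ctx) (q : ΔP ∋ A) → split {Δ = Δ} ΔP (inl q) ≡ inj₁ q
split-inl (B ∷ ΔP) here = refl
split-inl {Δ = Δ} (B ∷ ΔP) (there q) rewrite split-inl {Δ = Δ} ΔP q = refl

split-inr : (ΔP : Ctx) (q : Δ ∋ A) → split ΔP (inr ΔP q) ≡ inj₂ q
split-inr [] q = refl
split-inr (B ∷ ΔP) q rewrite split-inr ΔP q = refl

there-injective : {p q : Γ ∋ A} → there {B = B} p ≡ there q → p ≡ q
there-injective refl = refl

inr-injective : (ΔP : Ctx) {p q : Δ ∋ A} → inr ΔP p ≡ inr ΔP q → p ≡ q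
inr-injective [] e = e
inr-injective (B ∷ ΔP) e = inr-injective ΔP (there-injective e)

inl≢inr : (ΔP : Ctx) (p : ΔP ∋ A) (q : Δ ∋ A) → inl p ≢ inr ΔP q
inl≢inr (B ∷ ΔP) (there p) q e = inl≢inr ΔP p q (there-injective e)

wkAt-inl : (ΔP : Ctx) (q : ΔP ∋ A) → wkAt {ΔQ = ΔQ} {B = B} ΔP (inl q) ≡ inl q
wkAt-inl {ΔQ = ΔQ} ΔP q rewrite split-inl {Δ = ΔQ} ΔP q = refl

wkAt-inr : (ΔP : Ctx) (q : ΔQ ∋ A) → wkAt {B = B} ΔP (inr ΔP q) ≡ inr ΔP (there q)
wkAt-inr ΔP q rewrite split-inr ΔP q = refl

wkAt-misses : (ΔP : Ctx) (q : (ΔP ++ ΔQ) ∋ A) → wkAt ΔP q ≢ inr ΔP here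
wkAt-misses {ΔQ = ΔQ} {A = A} ΔP q e with splitView ΔP q
... | left q' = inl≢inr ΔP q' here (trans (sym (wkAt-inl {ΔQ = ΔQ} {B = A} ΔP q')) e)
... | right q' with inr-injective ΔP (trans (sym (wkAt-inr {B = A} ΔP q')) e)
... | ()

wkAt-ext : (ΔP : Ctx) (q : (C ∷ ΔP ++ ΔQ) ∋ A) →
           ext (wkAt {ΔQ = ΔQ} {B = B} ΔP) q ≡ wkAt (C ∷ ΔP) q
wkAt-ext ΔP here = refl
wkAt-ext ΔP (there q) with split ΔP q
... | inj₁ _ = refl
... | inj₂ _ = refl

swapAt-inl : (ΔP : Ctx) (q : ΔP ∋ C) → swapAt {A = A} {B = B} {ΔQ = ΔQ} ΔP (inl q) ≡ inl q
swapAt-inl {A = A} {B = B} {ΔQ = ΔQ} ΔP q rewrite split-inl {Δ = A ∷ B ∷ ΔQ} ΔP q = refl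

swapAt-inr : (ΔP : Ctx) (q : (A ∷ B ∷ ΔQ) ∋ C) → swapAt ΔP (inr ΔP q) ≡ inr ΔP (swapAt [] q)
swapAt-inr ΔP q rewrite split-inr ΔP q with q
... | here = refl
... | there here = refl
... | there (there _) = refl

swapAt-involutive : (ΔP : Ctx) (p : (ΔP ++ A ∷ B ∷ ΔQ) ∋ C) → swapAt ΔP (swapAt ΔP p) ≡ p
swapAt-involutive {A = A} {B = B} {ΔQ = ΔQ} ΔP p with splitView ΔP p
... | left q rewrite swapAt-inl {A = A} {B = B} {ΔQ = ΔQ} ΔP q
                  | swapAt-inl {A = B} {B = A} {ΔQ = ΔQ} ΔP q = refl
... | right q rewrite swapAt-inr ΔP q | swapAt-inr ΔP (swapAt [] q) = cong (inr ΔP) (swap-swap q)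
  where
  swap-swap : (q : (A ∷ B ∷ ΔQ) ∋ C) → swapAt [] (swapAt [] q) ≡ q
  swap-swap here = refl
  swap-swap (there here) = refl
  swap-swap (there (there _)) = refl

ext-cong : {ρ ρ' : Ren Γ Δ} → (∀ {A} (p : Γ ∋ A) → ρ p ≡ ρ' p) →
           (p : (B ∷ Γ) ∋ A) → ext ρ p ≡ ext ρ' p
ext-cong h here = refl
ext-cong h (there p) = cong there (h p)

mutual
  rename-cong : {ρ ρ' : Ren Γ Δ} → (∀ {A} (p : Γ ∋ A) → ρ p ≡ ρ' p) →
                (M : Tm Γ A) → rename ρ M ≡ rename ρ' M
  rename-cong h (var p) = cong var (h p)
  rename-cong h (lam M) = cong lam (rename-cong (ext-cong h) M)
  rename-cong h (app M N) = cong₂ app (rename-cong h M) (rename-cong h N)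
  rename-cong h (sub M σ) = cong (sub M) (renameˢ-cong h σ)

  renameˢ-cong : {ρ ρ' : Ren Γ Δ} → (∀ {A} (p : Γ ∋ A) → ρ p ≡ ρ' p) →
                 (σ : Subs Γ Ξ) → renameˢ ρ σ ≡ renameˢ ρ' σ
  renameˢ-cong h [] = refl
  renameˢ-cong h (N ∷ σ) = cong₂ _∷_ (rename-cong h N) (renameˢ-cong h σ)

ext-∘ : (ρ : Ren Γ Δ) (ρ' : Ren Δ Ξ) (p : (B ∷ Γ) ∋ A) →
        ext ρ' (ext ρ p) ≡ ext (λ q → ρ' (ρ q)) p
ext-∘ ρ ρ' here = refl
ext-∘ ρ ρ' (there p) = refl

mutual
  rename-∘ : (ρ : Ren Γ Δ) (ρ' : Ren Δ Ξ) (M : Tm Γ A) →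
             rename ρ' (rename ρ M) ≡ rename (λ p → ρ' (ρ p)) M
  rename-∘ ρ ρ' (var p) = refl
  rename-∘ ρ ρ' (lam M) =
    cong lam (trans (rename-∘ (ext ρ) (ext ρ') M) (rename-cong (ext-∘ ρ ρ') M))
  rename-∘ ρ ρ' (app M N) = cong₂ app (rename-∘ ρ ρ' M) (rename-∘ ρ ρ' N)
  rename-∘ ρ ρ' (sub M σ) = cong (sub M) (renameˢ-∘ ρ ρ' σ)

  renameˢ-∘ : (ρ : Ren Γ Δ) (ρ' : Ren Δ Ξ) (σ : Subs Γ ΔQ) →
              renameˢ ρ' (renameˢ ρ σ) ≡ renameˢ (λ p → ρ' (ρ p)) σ
  renameˢ-∘ ρ ρ' [] = refl
  renameˢ-∘ ρ ρ' (N ∷ σ) = cong₂ _∷_ (rename-∘ ρ ρ' N) (renameˢ-∘ ρ ρ' σ)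

ext-id : (p : (B ∷ Γ) ∋ A) → ext (λ q → q) p ≡ p
ext-id here = refl
ext-id (there p) = refl

mutual
  rename-id : (M : Tm Γ A) → rename (λ p → p) M ≡ M
  rename-id (var p) = refl
  rename-id (lam M) = cong lam (trans (rename-cong ext-id M) (rename-id M))
  rename-id (app M N) = cong₂ app (rename-id M) (rename-id N)
  rename-id (sub M σ) = cong (sub M) (renameˢ-id σ)

  renameˢ-id : (σ : Subs Γ Δ) → renameˢ (λ p → p) σ ≡ σ
  renameˢ-id [] = refl
  renameˢ-id (N ∷ σ) = cong₂ _∷_ (rename-id N) (renameˢ-id σ)

record IsRetractionOf (ρ' : Ren Δ Γ) (ρ : Ren Γ Δ) : Set where
  constructor retraction
  field retract : ∀ {A} (p : Γ ∋ A) → ρ' (ρ p) ≡ p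
open IsRetractionOf

ext-retraction : {ρ' : Ren Δ Γ} {ρ : Ren Γ Δ} →
                 IsRetractionOf ρ' ρ → IsRetractionOf (ext {A = B} ρ') (ext ρ)
ext-retraction inv = retraction λ where
  here → refl
  (there p) → cong there (retract inv p)

rename-retraction : {ρ' : Ren Δ Γ} {ρ : Ren Γ Δ} → IsRetractionOf ρ' ρ →
                    (M : Tm Γ A) → rename ρ' (rename ρ M) ≡ M
rename-retraction {ρ' = ρ'} {ρ} inv M =
  trans (rename-∘ ρ ρ' M) (trans (rename-cong (retract inv) M) (rename-id M))

swapAt-retraction : (ΔP : Ctx) →
                    IsRetractionOf (swapAt {A = B} {B = A} {ΔQ = ΔQ} ΔP) (swapAt ΔP)
swapAt-retraction ΔP = retraction (swapAt-involutive ΔP)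

lookup-renameˢ : (ρ : Ren Γ Δ) (σ : Subs Γ Ξ) (p : Ξ ∋ A) →
                 lookupˢ (renameˢ ρ σ) p ≡ rename ρ (lookupˢ σ p)
lookup-renameˢ ρ (N ∷ σ) here = refl
lookup-renameˢ ρ (N ∷ σ) (there p) = lookup-renameˢ ρ σ p

renameˢ-++ˢ : (ρ : Ren Γ Δ) (σ : Subs Γ ΔP) (τ : Subs Γ ΔQ) →
              renameˢ ρ (σ ++ˢ τ) ≡ renameˢ ρ σ ++ˢ renameˢ ρ τ
renameˢ-++ˢ ρ [] τ = refl
renameˢ-++ˢ ρ (N ∷ σ) τ = cong (rename ρ N ∷_) (renameˢ-++ˢ ρ σ τ)

lookup-inl : (σ : Subs Γ ΔP) (τ : Subs Γ ΔQ) (q : ΔP ∋ A) →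
             lookupˢ (σ ++ˢ τ) (inl q) ≡ lookupˢ σ q
lookup-inl (N ∷ σ) τ here = refl
lookup-inl (N ∷ σ) τ (there q) = lookup-inl σ τ q

lookup-inr : (σ : Subs Γ ΔP) (τ : Subs Γ ΔQ) (q : ΔQ ∋ A) →
             lookupˢ (σ ++ˢ τ) (inr ΔP q) ≡ lookupˢ τ q
lookup-inr [] τ q = refl
lookup-inr (N ∷ σ) τ q = lookup-inr σ τ q

lookup-swapAt : (ΔP : Ctx) (σP : Subs Γ ΔP) (N₁ : Tm Γ (□ A)) (N₂ : Tm Γ (□ B))
                (σQ : Subs Γ ΔQ) (p : (ΔP ++ B ∷ A ∷ ΔQ) ∋ C) →
                lookupˢ (σP ++ˢ (N₂ ∷ N₁ ∷ σQ)) p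
                  ≡ lookupˢ (σP ++ˢ (N₁ ∷ N₂ ∷ σQ)) (swapAt ΔP p)
lookup-swapAt {A = A} {B = B} {ΔQ = ΔQ} ΔP σP N₁ N₂ σQ p with splitView ΔP p
... | left q rewrite swapAt-inl {A = B} {B = A} {ΔQ = ΔQ} ΔP q
                   | lookup-inl σP (N₂ ∷ N₁ ∷ σQ) q | lookup-inl σP (N₁ ∷ N₂ ∷ σQ) q = refl
... | right q rewrite swapAt-inr ΔP q
                    | lookup-inr σP (N₂ ∷ N₁ ∷ σQ) q | lookup-inr σP (N₁ ∷ N₂ ∷ σQ) (swapAt [] q)
  with q
... | here = refl
... | there here = refl
... | there (there _) = refl

≈ˢ-refl : (σ : Subs Γ Δ) → σ ≈ˢ σ
≈ˢ-refl [] = []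
≈ˢ-refl (N ∷ σ) = ≈-refl ∷ ≈ˢ-refl σ

++ˢ-cong : {σ σ' : Subs Γ Δ} {τ τ' : Subs Γ Ξ} → σ ≈ˢ σ' → τ ≈ˢ τ' → (σ ++ˢ τ) ≈ˢ (σ' ++ˢ τ')
++ˢ-cong [] t = t
++ˢ-cong (e ∷ s) t = e ∷ ++ˢ-cong s t

lookup-≈ˢ : {σ σ' : Subs Γ Δ} → σ ≈ˢ σ' → (p : Δ ∋ A) → lookupˢ σ p ≈ lookupˢ σ' p
lookup-≈ˢ (e ∷ s) here = e
lookup-≈ˢ (e ∷ s) (there p) = lookup-≈ˢ s p

mutual
  ≈-rename : (ρ : Ren Γ Δ) {M N : Tm Γ A} → M ≈ N → rename ρ M ≈ rename ρ N
  ≈-rename ρ ≈-refl = ≈-refl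
  ≈-rename ρ (≈-sym e) = ≈-sym (≈-rename ρ e)
  ≈-rename ρ (≈-trans e e') = ≈-trans (≈-rename ρ e) (≈-rename ρ e')
  ≈-rename ρ (≈-lam e) = ≈-lam (≈-rename (ext ρ) e)
  ≈-rename ρ (≈-app e e') = ≈-app (≈-rename ρ e) (≈-rename ρ e')
  ≈-rename ρ (≈-sub e s) = ≈-sub e (≈ˢ-rename ρ s)
  ≈-rename ρ (≈-swap ΔP {σP = σP} {N₁ = N₁} {N₂ = N₂} {σQ = σQ})
    rewrite renameˢ-++ˢ ρ σP (N₁ ∷ N₂ ∷ σQ) | renameˢ-++ˢ ρ σP (N₂ ∷ N₁ ∷ σQ) = ≈-swap ΔP

  ≈ˢ-rename : (ρ : Ren Γ Δ) {σ σ' : Subs Γ Ξ} → σ ≈ˢ σ' → renameˢ ρ σ ≈ˢ renameˢ ρ σ'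
  ≈ˢ-rename ρ [] = []
  ≈ˢ-rename ρ (e ∷ s) = ≈-rename ρ e ∷ ≈ˢ-rename ρ s

≈-rename-reflect : {ρ' : Ren Δ Γ} {ρ : Ren Γ Δ} → IsRetractionOf ρ' ρ →
                   {M N : Tm Γ A} → rename ρ M ≈ rename ρ N → M ≈ N
≈-rename-reflect {ρ' = ρ'} inv {M} {N} e =
  subst₂ _≈_ (rename-retraction inv M) (rename-retraction inv N) (≈-rename ρ' e)

mutual
  occurs-rename : (ρ : Ren Γ Δ) {p : Γ ∋ A} {M : Tm Γ B} →
                  Occurs p M → Occurs (ρ p) (rename ρ M)
  occurs-rename ρ o-var = o-var
  occurs-rename ρ (o-lam o) = o-lam (occurs-rename (ext ρ) o)
  occurs-rename ρ (o-appL o) = o-appL (occurs-rename ρ o)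
  occurs-rename ρ (o-appR o) = o-appR (occurs-rename ρ o)
  occurs-rename ρ (o-sub o) = o-sub (occursˢ-rename ρ o)

  occursˢ-rename : (ρ : Ren Γ Δ) {p : Γ ∋ A} {σ : Subs Γ Ξ} →
                   Occursˢ p σ → Occursˢ (ρ p) (renameˢ ρ σ)
  occursˢ-rename ρ (hd o) = hd (occurs-rename ρ o)
  occursˢ-rename ρ (tl o) = tl (occursˢ-rename ρ o)

mutual
  occurs-rename-image : (ρ : Ren Γ Δ) {p : Δ ∋ A} (M : Tm Γ B) →
                        Occurs p (rename ρ M) → Σ (Γ ∋ A) λ q → ρ q ≡ p
  occurs-rename-image ρ (var q) o-var = q , refl
  occurs-rename-image ρ (lam M) (o-lam o) with occurs-rename-image (ext ρ) M o
  ... | there q , e = q , there-injective e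
  occurs-rename-image ρ (app M N) (o-appL o) = occurs-rename-image ρ M o
  occurs-rename-image ρ (app M N) (o-appR o) = occurs-rename-image ρ N o
  occurs-rename-image ρ (sub M σ) (o-sub o) = occursˢ-rename-image ρ σ o

  occursˢ-rename-image : (ρ : Ren Γ Δ) {p : Δ ∋ A} (σ : Subs Γ Ξ) →
                         Occursˢ p (renameˢ ρ σ) → Σ (Γ ∋ A) λ q → ρ q ≡ p
  occursˢ-rename-image ρ (N ∷ σ) (hd o) = occurs-rename-image ρ N o
  occursˢ-rename-image ρ (N ∷ σ) (tl o) = occursˢ-rename-image ρ σ o

occursˢ-swap : (σP : Subs Γ ΔP) {N₁ : Tm Γ (□ A)} {N₂ : Tm Γ (□ B)} {σQ : Subs Γ ΔQ}
               {p : Γ ∋ C} →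
               Occursˢ p (σP ++ˢ (N₁ ∷ N₂ ∷ σQ)) → Occursˢ p (σP ++ˢ (N₂ ∷ N₁ ∷ σQ))
occursˢ-swap [] (hd o) = tl (hd o)
occursˢ-swap [] (tl (hd o)) = hd o
occursˢ-swap [] (tl (tl o)) = tl (tl o)
occursˢ-swap (N ∷ σP) (hd o) = hd o
occursˢ-swap (N ∷ σP) (tl o) = tl (occursˢ-swap σP o)

mutual
  occurs-≈ : {M N : Tm Γ B} → M ≈ N → {p : Γ ∋ A} → Occurs p M ⇔ Occurs p N
  occurs-≈ ≈-refl = ⇔-id _
  occurs-≈ (≈-sym e) = ⇔-sym (occurs-≈ e)
  occurs-≈ (≈-trans e e') = occurs-≈ e' ⇔-∘ occurs-≈ e
  occurs-≈ (≈-lam e) = mk⇔ (λ { (o-lam o) → o-lam (to (occurs-≈ e) o) })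
                           (λ { (o-lam o) → o-lam (from (occurs-≈ e) o) })
  occurs-≈ (≈-app e e') =
    mk⇔ (λ { (o-appL o) → o-appL (to (occurs-≈ e) o) ; (o-appR o) → o-appR (to (occurs-≈ e') o) })
        (λ { (o-appL o) → o-appL (from (occurs-≈ e) o) ; (o-appR o) → o-appR (from (occurs-≈ e') o) })
  occurs-≈ (≈-sub e s) = mk⇔ (λ { (o-sub o) → o-sub (to (occursˢ-≈ s) o) })
                             (λ { (o-sub o) → o-sub (from (occursˢ-≈ s) o) })
  occurs-≈ (≈-swap ΔP {σP = σP}) = mk⇔ (λ { (o-sub o) → o-sub (occursˢ-swap σP o) })
                                       (λ { (o-sub o) → o-sub (occursˢ-swap σP o) })

  occursˢ-≈ : {σ σ' : Subs Γ Ξ} → σ ≈ˢ σ' → {p : Γ ∋ A} → Occursˢ p σ ⇔ Occursˢ p σ'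
  occursˢ-≈ [] = mk⇔ (λ ()) (λ ())
  occursˢ-≈ (e ∷ s) =
    mk⇔ (λ { (hd o) → hd (to (occurs-≈ e) o) ; (tl o) → tl (to (occursˢ-≈ s) o) })
        (λ { (hd o) → hd (from (occurs-≈ e) o) ; (tl o) → tl (from (occursˢ-≈ s) o) })

-- Λ̂ is closed under permutation of substitution pairs

mutual
  hat-rename : {ρ' : Ren Δ Γ} (ρ : Ren Γ Δ) → IsRetractionOf ρ' ρ →
               {M : Tm Γ A} → Hat M → Hat (rename ρ M)
  hat-rename ρ inv (h-ne s) = h-ne (spine-rename ρ inv s)
  hat-rename ρ inv (h-lam h) = h-lam (hat-rename (ext ρ) (ext-retraction inv) h)
  hat-rename ρ inv (h-sub {σ = σ} hM occ sp dist) = h-sub hM occ sp' dist'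
    where
    sp' : ∀ {B} (p : _ ∋ B) → Spine (lookupˢ (renameˢ ρ σ) p)
    sp' p = ≡-subst Spine (sym (lookup-renameˢ ρ σ p)) (spine-rename ρ inv (sp p))
    dist' : Distinct (renameˢ ρ σ)
    dist' p q p≢q e = dist p q p≢q (≈-rename-reflect inv
      (subst₂ _≈_ (lookup-renameˢ ρ σ p) (lookup-renameˢ ρ σ q) e))

  spine-rename : {ρ' : Ren Δ Γ} (ρ : Ren Γ Δ) → IsRetractionOf ρ' ρ →
                 {M : Tm Γ A} → Spine M → Spine (rename ρ M)
  spine-rename ρ inv (s-var p) = s-var (ρ p)
  spine-rename ρ inv (s-app s h) = s-app (spine-rename ρ inv s) (hat-rename ρ inv h)

hat-swap : (ΔP : Ctx) {M : Tm (ΔP ++ A ∷ B ∷ ΔQ) C} {σP : Subs Γ ΔP}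
           {N₁ : Tm Γ (□ A)} {N₂ : Tm Γ (□ B)} {σQ : Subs Γ ΔQ} →
           Hat (sub M (σP ++ˢ (N₁ ∷ N₂ ∷ σQ))) →
           Hat (sub (rename (swapAt ΔP) M) (σP ++ˢ (N₂ ∷ N₁ ∷ σQ)))
hat-swap ΔP {M} {σP} {N₁} {N₂} {σQ} (h-sub hM occ sp dist) =
  h-sub (hat-rename (swapAt ΔP) (swapAt-retraction ΔP) hM) occ' sp' dist'
  where
  occ' : ∀ {X} (p : _ ∋ X) → Occurs p (rename (swapAt ΔP) M)
  occ' p = ≡-subst (λ q → Occurs q (rename (swapAt ΔP) M)) (swapAt-involutive ΔP p)
                   (occurs-rename (swapAt ΔP) (occ (swapAt ΔP p)))
  sp' : ∀ {X} (p : _ ∋ X) → Spine (lookupˢ (σP ++ˢ (N₂ ∷ N₁ ∷ σQ)) p)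
  sp' p = ≡-subst Spine (sym (lookup-swapAt ΔP σP N₁ N₂ σQ p)) (sp (swapAt ΔP p))
  dist' : Distinct (σP ++ˢ (N₂ ∷ N₁ ∷ σQ))
  dist' p q p≢q e = dist (swapAt ΔP p) (swapAt ΔP q)
    (λ e' → p≢q (trans (sym (swapAt-involutive ΔP p))
                       (trans (cong (swapAt ΔP) e') (swapAt-involutive ΔP q))))
    (subst₂ _≈_ (lookup-swapAt ΔP σP N₁ N₂ σQ p) (lookup-swapAt ΔP σP N₁ N₂ σQ q) e)

hat-unswap : (ΔP : Ctx) {M : Tm (ΔP ++ A ∷ B ∷ ΔQ) C} {σP : Subs Γ ΔP}
             {N₁ : Tm Γ (□ A)} {N₂ : Tm Γ (□ B)} {σQ : Subs Γ ΔQ} →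
             Hat (sub (rename (swapAt ΔP) M) (σP ++ˢ (N₂ ∷ N₁ ∷ σQ))) →
             Hat (sub M (σP ++ˢ (N₁ ∷ N₂ ∷ σQ)))
hat-unswap ΔP {M} {σP} {N₁} {N₂} {σQ} h =
  ≡-subst (λ K → Hat (sub K (σP ++ˢ (N₁ ∷ N₂ ∷ σQ))))
    (rename-retraction (swapAt-retraction ΔP) M) (hat-swap ΔP h)

mutual
  hat-≈ : {M N : Tm Γ A} → M ≈ N → Hat M ⇔ Hat N
  hat-≈ ≈-refl = ⇔-id _
  hat-≈ (≈-sym e) = ⇔-sym (hat-≈ e)
  hat-≈ (≈-trans e e') = hat-≈ e' ⇔-∘ hat-≈ e
  hat-≈ (≈-lam e) = mk⇔ (λ { (h-lam h) → h-lam (to (hat-≈ e) h) })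
                        (λ { (h-lam h) → h-lam (from (hat-≈ e) h) })
  hat-≈ (≈-app e e') = mk⇔ (λ { (h-ne s) → h-ne (to (spine-app-≈ e e') s) })
                           (λ { (h-ne s) → h-ne (from (spine-app-≈ e e') s) })
  hat-≈ (≈-sub e s) =
    mk⇔ (λ { (h-sub hM occ sp dist) →
               h-sub (to (hat-≈ e) hM) (λ p → to (occurs-≈ e) (occ p))
                     (λ p → to (lookup-spine-≈ˢ s p) (sp p))
                     (λ p q p≢q e' → dist p q p≢q
                        (≈-trans (lookup-≈ˢ s p) (≈-trans e' (≈-sym (lookup-≈ˢ s q))))) })
        (λ { (h-sub hM occ sp dist) →
               h-sub (from (hat-≈ e) hM) (λ p → from (occurs-≈ e) (occ p))
                     (λ p → from (lookup-spine-≈ˢ s p) (sp p))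
                     (λ p q p≢q e' → dist p q p≢q
                        (≈-trans (≈-sym (lookup-≈ˢ s p)) (≈-trans e' (lookup-≈ˢ s q)))) })
  hat-≈ (≈-swap ΔP) = mk⇔ (hat-swap ΔP) (hat-unswap ΔP)

  spine-≈ : {M N : Tm Γ A} → M ≈ N → Spine M ⇔ Spine N
  spine-≈ ≈-refl = ⇔-id _
  spine-≈ (≈-sym e) = ⇔-sym (spine-≈ e)
  spine-≈ (≈-trans e e') = spine-≈ e' ⇔-∘ spine-≈ e
  spine-≈ (≈-lam e) = mk⇔ (λ ()) (λ ())
  spine-≈ (≈-app e e') = spine-app-≈ e e'
  spine-≈ (≈-sub e s) = mk⇔ (λ ()) (λ ())
  spine-≈ (≈-swap ΔP) = mk⇔ (λ ()) (λ ())

  spine-app-≈ : {M M' : Tm Γ (A ⇒ C)} {N N' : Tm Γ A} → M ≈ M' → N ≈ N' →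
                Spine (app M N) ⇔ Spine (app M' N')
  spine-app-≈ e e' = mk⇔ (λ { (s-app s h) → s-app (to (spine-≈ e) s) (to (hat-≈ e') h) })
                         (λ { (s-app s h) → s-app (from (spine-≈ e) s) (from (hat-≈ e') h) })

  lookup-spine-≈ˢ : {σ σ' : Subs Γ Δ} → σ ≈ˢ σ' → (p : Δ ∋ A) →
                    Spine (lookupˢ σ p) ⇔ Spine (lookupˢ σ' p)
  lookup-spine-≈ˢ (e ∷ s) here = spine-≈ e
  lookup-spine-≈ˢ (e ∷ s) (there p) = lookup-spine-≈ˢ s p

-- Terms of Λ̂ are normal

ground-sub-impossible : {M : Tm Δ C} {σ : Subs Γ Δ} {N : Tm Γ (□ C)} →
                        (∀ {B} (p : Δ ∋ B) → Occurs p M) →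
                        (∀ {B} (p : Δ ∋ B) → Spine (lookupˢ σ p)) →
                        Distinct σ → ¬ Ground (sub M σ) N
ground-sub-impossible occ sp dist (β₂ ΔP M σP R τ σQ)
  with ≡-subst Spine (lookup-inr σP (sub R τ ∷ σQ) here) (sp (inr ΔP here))
... | ()
ground-sub-impossible occ sp dist (κ₁ ΔP M σP N σQ)
  with occurs-rename-image (wkAt ΔP) M (occ (inr ΔP here))
... | q , e = wkAt-misses ΔP q e
ground-sub-impossible occ sp dist (κ₂ ΔP M σP N σQ) =
  dist (inr ΔP here) (inr ΔP (there here)) (λ e → here≢there (inr-injective ΔP e))
    (subst₂ _≈_ (sym (lookup-inr σP (N ∷ N ∷ σQ) here))
                (sym (lookup-inr σP (N ∷ N ∷ σQ) (there here))) ≈-refl)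
  where
  here≢there : {p : Ξ ∋ A} → here {A = A} ≢ there p
  here≢there ()

mutual
  hat-βκ : {M N : Tm Γ A} → Hat M → ¬ M ⟶βκ N
  hat-βκ (h-ne s) st = spine-βκ s st
  hat-βκ (h-lam h) (c-lam st) = hat-βκ h st
  hat-βκ (h-sub hM occ sp dist) (ground g) = ground-sub-impossible occ sp dist g
  hat-βκ (h-sub hM occ sp dist) (c-subB st) = hat-βκ hM st
  hat-βκ (h-sub hM occ sp dist) (c-subA st) = spines-βκ sp st

  spine-βκ : {M N : Tm Γ A} → Spine M → ¬ M ⟶βκ N
  spine-βκ (s-app () h) (ground (β₁ _ _))
  spine-βκ (s-app s h) (c-appL st) = spine-βκ s st
  spine-βκ (s-app s h) (c-appR st) = hat-βκ h st

  spines-βκ : {σ σ' : Subs Γ Δ} → (∀ {B} (p : Δ ∋ B) → Spine (lookupˢ σ p)) → ¬ σ ⟶βκˢ σ'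
  spines-βκ sp (hd st) = spine-βκ (sp here) st
  spines-βκ sp (tl st) = spines-βκ (λ p → sp (there p)) st

mutual
  hat-η₁ : {M N : Tm Γ A} → Hat M → ¬ η₁⟨ b ⟩ M N
  hat-η₁ (h-ne (s-app s h)) (e-appL st) = spine-η₁ s st
  hat-η₁ (h-ne (s-app s h)) (e-appR st) = hat-η₁ h st
  hat-η₁ (h-lam h) (e-top not-lam) = not-lam tt
  hat-η₁ (h-lam h) (e-lam st) = hat-η₁ h st
  hat-η₁ (h-sub hM occ sp dist) (e-subB st) = hat-η₁ hM st
  hat-η₁ (h-sub hM occ sp dist) (e-subA st) = spines-η₁ sp st

  spine-η₁ : {M N : Tm Γ A} → Spine M → ¬ η₁⟨ false ⟩ M N
  spine-η₁ (s-app s h) (e-appL st) = spine-η₁ s st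
  spine-η₁ (s-app s h) (e-appR st) = hat-η₁ h st

  spines-η₁ : {σ σ' : Subs Γ Δ} → (∀ {B} (p : Δ ∋ B) → Spine (lookupˢ σ p)) → ¬ η₁ˢ σ σ'
  spines-η₁ sp (hd {b = false} st) = spine-η₁ (sp here) st
  spines-η₁ sp (tl st) = spines-η₁ (λ p → sp (there p)) st

mutual
  hat-η₂ : {M N : Tm Γ A} → Hat M → ¬ η₂⟨ b ⟩ M N
  hat-η₂ {b = false} (h-ne s) st = spine-η₂ s st
  hat-η₂ (h-lam h) (d-lam st) = hat-η₂ h st
  hat-η₂ (h-sub hM occ sp dist) (d-top not-sub) = not-sub tt
  hat-η₂ (h-sub hM occ sp dist) (d-subB st) = hat-η₂ hM st
  hat-η₂ (h-sub hM occ sp dist) (d-subA st) = spines-η₂ sp st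

  spine-η₂ : {M N : Tm Γ A} → Spine M → ¬ η₂⟨ false ⟩ M N
  spine-η₂ (s-app s h) (d-appL {b = false} st) = spine-η₂ s st
  spine-η₂ (s-app s h) (d-appR st) = hat-η₂ h st

  spines-η₂ : {σ σ' : Subs Γ Δ} → (∀ {B} (p : Δ ∋ B) → Spine (lookupˢ σ p)) → ¬ η₂ˢ σ σ'
  spines-η₂ sp (hd st) = spine-η₂ (sp here) st
  spines-η₂ sp (tl st) = spines-η₂ (λ p → sp (there p)) st

hat⇒normal : {M : Tm Γ A} → Hat M → Normal M
hat⇒normal h (N , M' , e , βκ st) = hat-βκ (to (hat-≈ e) h) st
hat⇒normal h (N , M' , e , η₁ st) = hat-η₁ (to (hat-≈ e) h) st
hat⇒normal h (N , M' , e , η₂ st) = hat-η₂ (to (hat-≈ e) h) st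

Strengthening : (ΔP : Ctx) → Tm (ΔP ++ B ∷ ΔQ) C → Set
Strengthening {ΔQ = ΔQ} {C = C} ΔP M = Σ (Tm (ΔP ++ ΔQ) C) λ M' → rename (wkAt ΔP) M' ≡ M

Strengtheningˢ : (ΔP : Ctx) → Subs (ΔP ++ B ∷ ΔQ) Ξ → Set
Strengtheningˢ {ΔQ = ΔQ} {Ξ = Ξ} ΔP σ =
  Σ (Subs (ΔP ++ ΔQ) Ξ) λ σ' → renameˢ (wkAt ΔP) σ' ≡ σ

mutual
  occurs-or-strengthen : (ΔP : Ctx) (M : Tm (ΔP ++ B ∷ ΔQ) C) →
                         Occurs (inr ΔP here) M ⊎ Strengthening ΔP M
  occurs-or-strengthen {B = B} {ΔQ = ΔQ} ΔP (var q) with splitView ΔP q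
  ... | left q' = inj₂ (var (inl q') , cong var (wkAt-inl {ΔQ = ΔQ} {B = B} ΔP q'))
  ... | right here = inj₁ o-var
  ... | right (there q') = inj₂ (var (inr ΔP q') , cong var (wkAt-inr ΔP q'))
  occurs-or-strengthen ΔP (lam {A = A} M) with occurs-or-strengthen (A ∷ ΔP) M
  ... | inj₁ o = inj₁ (o-lam o)
  ... | inj₂ (M' , e) = inj₂ (lam M' , cong lam (trans (rename-cong (wkAt-ext ΔP) M') e))
  occurs-or-strengthen ΔP (app M N)
    with occurs-or-strengthen ΔP M | occurs-or-strengthen ΔP N
  ... | inj₁ o | _ = inj₁ (o-appL o)
  ... | inj₂ _ | inj₁ o = inj₁ (o-appR o)
  ... | inj₂ (M' , e) | inj₂ (N' , e') = inj₂ (app M' N' , cong₂ app e e')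
  occurs-or-strengthen ΔP (sub M σ) with occursˢ-or-strengthen ΔP σ
  ... | inj₁ o = inj₁ (o-sub o)
  ... | inj₂ (σ' , e) = inj₂ (sub M σ' , cong (sub M) e)

  occursˢ-or-strengthen : (ΔP : Ctx) (σ : Subs (ΔP ++ B ∷ ΔQ) Ξ) →
                          Occursˢ (inr ΔP here) σ ⊎ Strengtheningˢ ΔP σ
  occursˢ-or-strengthen ΔP [] = inj₂ ([] , refl)
  occursˢ-or-strengthen ΔP (N ∷ σ)
    with occurs-or-strengthen ΔP N | occursˢ-or-strengthen ΔP σ
  ... | inj₁ o | _ = inj₁ (hd o)
  ... | inj₂ _ | inj₁ o = inj₁ (tl o)
  ... | inj₂ (N' , e) | inj₂ (σ' , e') = inj₂ (N' ∷ σ' , cong₂ _∷_ e e')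

Reducible : Tm Γ A → Set
Reducible {Γ} {A} M = Σ (Tm Γ A) λ N → M ⇝ N

reducible-≈ : {M M' : Tm Γ A} → M ≈ M' → Reducible M' → Reducible M
reducible-≈ e (N , M'' , e' , st) = N , M'' , ≈-trans e e' , st

reducible-step : {M N : Tm Γ A} → Step M N → Reducible M
reducible-step {N = N} st = N , _ , ≈-refl , st

reducible-ground : {M N : Tm Γ A} → Ground M N → Reducible M
reducible-ground g = reducible-step (βκ (ground g))

data Position (B : Ty) : (Δ : Ctx) → Δ ∋ B → Set where
  position : (ΔP ΔQ : Ctx) → Position B (ΔP ++ B ∷ ΔQ) (inr ΔP here)

positionView : (p : Δ ∋ B) → Position B Δ p
positionView here = position [] _
positionView (there p) with positionView p
... | position ΔP ΔQ = position (_ ∷ ΔP) ΔQ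

data SplitSubs {Γ : Ctx} (ΔP : Ctx) {Δ : Ctx} : Subs Γ (ΔP ++ Δ) → Set where
  _++ˢ-split_ : (σP : Subs Γ ΔP) (σQ : Subs Γ Δ) → SplitSubs ΔP (σP ++ˢ σQ)

splitSubs : (ΔP : Ctx) (σ : Subs Γ (ΔP ++ Δ)) → SplitSubs ΔP σ
splitSubs [] σ = [] ++ˢ-split σ
splitSubs (A ∷ ΔP) (N ∷ σ) with splitSubs ΔP σ
... | σP ++ˢ-split σQ = (N ∷ σP) ++ˢ-split σQ

occurs-or-reducible : (M : Tm Δ C) (σ : Subs Γ Δ) (p : Δ ∋ B) →
                      Occurs p M ⊎ Reducible (sub M σ)
occurs-or-reducible M σ p with positionView p
... | position ΔP ΔQ with splitSubs ΔP σ
... | σP ++ˢ-split (N ∷ σQ) with occurs-or-strengthen ΔP M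
... | inj₁ occ = inj₁ occ
... | inj₂ (M' , refl) = inj₂ (reducible-ground (κ₁ ΔP M' σP N σQ))

sub-argument-reducible : (M : Tm Δ C) (σ : Subs Γ Δ) (p : Δ ∋ B) →
                         IsSub (lookupˢ σ p) → Reducible (sub M σ)
sub-argument-reducible M σ p is-sub with positionView p
... | position ΔP ΔQ with splitSubs ΔP σ
... | σP ++ˢ-split (N ∷ σQ) rewrite lookup-inr σP (N ∷ σQ) here with N
... | sub R τ = reducible-ground (β₂ ΔP M σP R τ σQ)

-- _++_ is not definitionally associative, so moving the first suffix
-- variable into the prefix needs a cast along ++-assoc.
castᵗ : Δ ≡ Ξ → Tm Δ C → Tm Ξ C
castᵗ {C = C} = ≡-subst (λ Δ → Tm Δ C)

castˢ : Δ ≡ Ξ → Subs Γ Δ → Subs Γ Ξ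
castˢ {Γ = Γ} = ≡-subst (Subs Γ)

castˢ-∷ : (e : Δ ≡ Ξ) (N : Tm Γ (□ B)) (σ : Subs Γ Δ) →
          castˢ (cong (B ∷_) e) (N ∷ σ) ≡ N ∷ castˢ e σ
castˢ-∷ refl N σ = refl

++ˢ-assoc : (σP : Subs Γ ΔP) (σQ : Subs Γ ΔQ) (σR : Subs Γ Ξ) →
            castˢ (++-assoc ΔP ΔQ Ξ) ((σP ++ˢ σQ) ++ˢ σR) ≡ σP ++ˢ (σQ ++ˢ σR)
++ˢ-assoc [] σQ σR = refl
++ˢ-assoc {ΔP = _ ∷ ΔP} {ΔQ = ΔQ} {Ξ = Ξ} (N ∷ σP) σQ σR =
  trans (castˢ-∷ (++-assoc ΔP ΔQ Ξ) N _) (cong (N ∷_) (++ˢ-assoc σP σQ σR))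

sub-castˢ : (e : Δ ≡ Ξ) (M : Tm Ξ C) (σ : Subs Γ Δ) → sub M (castˢ e σ) ≡ sub (castᵗ (sym e) M) σ
sub-castˢ refl M σ = refl

shiftᵗ : (ΔP : Ctx) → Tm (ΔP ++ B ∷ Δ) C → Tm ((ΔP ++ B ∷ []) ++ Δ) C
shiftᵗ {B = B} {Δ = Δ} ΔP = castᵗ (sym (++-assoc ΔP (B ∷ []) Δ))

sub-shift : (ΔP : Ctx) (M : Tm (ΔP ++ B ∷ Δ) C) (σP : Subs Γ ΔP) (N : Tm Γ (□ B)) (σ : Subs Γ Δ) →
            sub M (σP ++ˢ (N ∷ σ)) ≡ sub (shiftᵗ ΔP M) ((σP ++ˢ (N ∷ [])) ++ˢ σ)
sub-shift {B = B} {Δ = Δ} ΔP M σP N σ =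
  trans (cong (sub M) (sym (++ˢ-assoc σP (N ∷ []) σ))) (sub-castˢ (++-assoc ΔP (B ∷ []) Δ) M _)

-- N travels to the right by swaps until it is adjacent to its duplicate.
duplicate-reducible : (ΔP : Ctx) (M : Tm (ΔP ++ A ∷ Δ) C) (σP : Subs Γ ΔP)
                      (N : Tm Γ (□ A)) (σ : Subs Γ Δ) (q : Δ ∋ A) →
                      N ≈ lookupˢ σ q → Reducible (sub M (σP ++ˢ (N ∷ σ)))
duplicate-reducible ΔP M σP N (N' ∷ σQ) here e =
  reducible-≈ (≈-sub ≈-refl (++ˢ-cong (≈ˢ-refl σP) (≈-refl ∷ ≈-sym e ∷ ≈ˢ-refl σQ)))
    (reducible-ground (κ₂ ΔP M σP N σQ))
duplicate-reducible ΔP M σP N (_∷_ {A = B} X σ) (there q) e =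
  reducible-≈ (≈-swap ΔP)
    (≡-subst Reducible (sym (sub-shift ΔP (rename (swapAt ΔP) M) σP X (N ∷ σ)))
      (duplicate-reducible (ΔP ++ B ∷ []) (shiftᵗ ΔP (rename (swapAt ΔP) M))
                           (σP ++ˢ (X ∷ [])) N σ q e))

duplicates-reducible : (ΔP : Ctx) (M : Tm (ΔP ++ Δ) C) (σP : Subs Γ ΔP) (σ : Subs Γ Δ)
                       (p q : Δ ∋ B) → p ≢ q → lookupˢ σ p ≈ lookupˢ σ q →
                       Reducible (sub M (σP ++ˢ σ))
duplicates-reducible ΔP M σP (N ∷ σ) here here p≢q e = ⊥-elim (p≢q refl)
duplicates-reducible ΔP M σP (N ∷ σ) here (there q) p≢q e = duplicate-reducible ΔP M σP N σ q e
duplicates-reducible ΔP M σP (N ∷ σ) (there p) here p≢q e =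
  duplicate-reducible ΔP M σP N σ p (≈-sym e)
duplicates-reducible ΔP M σP (_∷_ {A = B} X σ) (there p) (there q) p≢q e =
  ≡-subst Reducible (sym (sub-shift ΔP M σP X σ))
    (duplicates-reducible (ΔP ++ B ∷ []) (shiftᵗ ΔP M) (σP ++ˢ (X ∷ [])) σ p q
                          (λ p≡q → p≢q (cong there p≡q)) e)

-- Normal terms belong to Λ̂

data InnerStep {Γ : Ctx} {A : Ty} (M N : Tm Γ A) : Set where
  βκ : M ⟶βκ N → InnerStep M N
  η₁ : η₁⟨ false ⟩ M N → InnerStep M N
  η₂ : η₂⟨ false ⟩ M N → InnerStep M N

-- No step except possibly a root η-expansion.  The grammars E and D forbid
-- exactly such steps in the head of an application (η₁) and in the
-- arguments of an explicit substitution (η₂).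
InnerNormal : Tm Γ A → Set
InnerNormal {Γ} {A} M = ∀ {M' N : Tm Γ A} → M ≈ M' → ¬ InnerStep M' N

data ArgStep {Γ Δ : Ctx} (σ σ' : Subs Γ Δ) : Set where
  βκ : σ ⟶βκˢ σ' → ArgStep σ σ'
  η₁ : η₁ˢ σ σ' → ArgStep σ σ'
  η₂ : η₂ˢ σ σ' → ArgStep σ σ'

ArgsNormal : Subs Γ Δ → Set
ArgsNormal {Γ} {Δ} σ = ∀ {σ' σ'' : Subs Γ Δ} → σ ≈ˢ σ' → ¬ ArgStep σ' σ''

normal⇒inner-normal : {M : Tm Γ A} → Normal M → InnerNormal M
normal⇒inner-normal n e (βκ s) = n (_ , _ , e , βκ s)
normal⇒inner-normal n e (η₁ s) = n (_ , _ , e , η₁ s)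
normal⇒inner-normal n e (η₂ s) = n (_ , _ , e , η₂ s)

normal-lam : {M : Tm (A ∷ Γ) C} → Normal (lam M) → Normal M
normal-lam n (N , M' , e , βκ s) = n (lam N , lam M' , ≈-lam e , βκ (c-lam s))
normal-lam n (N , M' , e , η₁ s) = n (lam N , lam M' , ≈-lam e , η₁ (e-lam s))
normal-lam n (N , M' , e , η₂ s) = n (lam N , lam M' , ≈-lam e , η₂ (d-lam s))

inner-normal-appL : {M : Tm Γ (A ⇒ C)} {N : Tm Γ A} → InnerNormal (app M N) → InnerNormal M
inner-normal-appL h e (βκ s) = h (≈-app e ≈-refl) (βκ (c-appL s))
inner-normal-appL h e (η₁ s) = h (≈-app e ≈-refl) (η₁ (e-appL s))
inner-normal-appL h e (η₂ s) = h (≈-app e ≈-refl) (η₂ (d-appL s))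

inner-normal-appR : {M : Tm Γ (A ⇒ C)} {N : Tm Γ A} → InnerNormal (app M N) → Normal N
inner-normal-appR h (N' , N'' , e , βκ s) = h (≈-app ≈-refl e) (βκ (c-appR s))
inner-normal-appR h (N' , N'' , e , η₁ s) = h (≈-app ≈-refl e) (η₁ (e-appR s))
inner-normal-appR h (N' , N'' , e , η₂ s) = h (≈-app ≈-refl e) (η₂ (d-appR s))

inner-normal-head-not-lam : {M : Tm Γ (A ⇒ C)} {N : Tm Γ A} → InnerNormal (app M N) → ¬ IsLam M
inner-normal-head-not-lam {M = lam M} {N} h _ = h ≈-refl (βκ (ground (β₁ M N)))

normal-sub-body : {M : Tm Δ C} {σ : Subs Γ Δ} → Normal (sub M σ) → Normal M
normal-sub-body n (N , M' , e , βκ s) = n (_ , _ , ≈-sub e (≈ˢ-refl _) , βκ (c-subB s))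
normal-sub-body n (N , M' , e , η₁ s) = n (_ , _ , ≈-sub e (≈ˢ-refl _) , η₁ (e-subB s))
normal-sub-body n (N , M' , e , η₂ s) = n (_ , _ , ≈-sub e (≈ˢ-refl _) , η₂ (d-subB s))

normal-sub-args : {M : Tm Δ C} {σ : Subs Γ Δ} → Normal (sub M σ) → ArgsNormal σ
normal-sub-args n s (βκ a) = n (_ , _ , ≈-sub ≈-refl s , βκ (c-subA a))
normal-sub-args n s (η₁ a) = n (_ , _ , ≈-sub ≈-refl s , η₁ {b = false} (e-subA a))
normal-sub-args n s (η₂ a) = n (_ , _ , ≈-sub ≈-refl s , η₂ {b = false} (d-subA a))

args-normal-lookup : (σ : Subs Γ Δ) → ArgsNormal σ → (p : Δ ∋ B) → InnerNormal (lookupˢ σ p)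
args-normal-lookup (N ∷ σ) ok here e (βκ s) = ok (e ∷ ≈ˢ-refl σ) (βκ (hd s))
args-normal-lookup (N ∷ σ) ok here e (η₁ s) = ok (e ∷ ≈ˢ-refl σ) (η₁ (hd s))
args-normal-lookup (N ∷ σ) ok here e (η₂ s) = ok (e ∷ ≈ˢ-refl σ) (η₂ (hd s))
args-normal-lookup (N ∷ σ) ok (there p) = args-normal-lookup σ ok-tail p
  where
  ok-tail : ArgsNormal σ
  ok-tail s (βκ a) = ok (≈-refl ∷ s) (βκ (tl a))
  ok-tail s (η₁ a) = ok (≈-refl ∷ s) (η₁ (tl a))
  ok-tail s (η₂ a) = ok (≈-refl ∷ s) (η₂ (tl a))

box-not-lam : (M : Tm Γ (□ A)) → ¬ IsLam M
box-not-lam (var _) ()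
box-not-lam (app _ _) ()
box-not-lam (sub _ _) ()

arrow-not-sub : (M : Tm Γ (A ⇒ C)) → ¬ IsSub M
arrow-not-sub (var _) ()
arrow-not-sub (lam _) ()
arrow-not-sub (app _ _) ()

mutual
  normal⇒hat : (M : Tm Γ A) → Normal M → Hat M
  normal⇒hat {A = atom a} (var p) n = h-ne (s-var p)
  normal⇒hat {A = A ⇒ C} (var p) n = ⊥-elim (n (reducible-step (η₁ (e-top λ ()))))
  normal⇒hat {A = □ A} (var p) n = ⊥-elim (n (reducible-step (η₂ (d-top λ ()))))
  normal⇒hat (lam M) n = h-lam (normal⇒hat M (normal-lam n))
  normal⇒hat {A = atom a} (app M N) n =
    h-ne (inner-normal⇒spine (app M N) (λ ()) (λ ()) (normal⇒inner-normal n))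
  normal⇒hat {A = A ⇒ C} (app M N) n = ⊥-elim (n (reducible-step (η₁ (e-top λ ()))))
  normal⇒hat {A = □ A} (app M N) n = ⊥-elim (n (reducible-step (η₂ (d-top λ ()))))
  normal⇒hat (sub M σ) n =
    h-sub (normal⇒hat M (normal-sub-body n))
      (λ p → [ id , (λ r → ⊥-elim (n r)) ]′ (occurs-or-reducible M σ p))
      (inner-normal⇒spines σ (λ p is-sub → n (sub-argument-reducible M σ p is-sub))
                              (args-normal-lookup σ (normal-sub-args n)))
      (λ p q p≢q e → n (duplicates-reducible [] M [] σ p q p≢q e))

  inner-normal⇒spine : (M : Tm Γ A) → ¬ IsLam M → ¬ IsSub M → InnerNormal M → Spine M
  inner-normal⇒spine (var p) not-lam not-sub h = s-var p
  inner-normal⇒spine (lam M) not-lam not-sub h = ⊥-elim (not-lam tt)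
  inner-normal⇒spine (sub M σ) not-lam not-sub h = ⊥-elim (not-sub tt)
  inner-normal⇒spine (app M N) not-lam not-sub h =
    s-app (inner-normal⇒spine M (inner-normal-head-not-lam h) (arrow-not-sub M)
                              (inner-normal-appL h))
          (normal⇒hat N (inner-normal-appR h))

  inner-normal⇒spines : (σ : Subs Γ Δ) → (∀ {B} (p : Δ ∋ B) → ¬ IsSub (lookupˢ σ p)) →
                        (∀ {B} (p : Δ ∋ B) → InnerNormal (lookupˢ σ p)) →
                        ∀ {B} (p : Δ ∋ B) → Spine (lookupˢ σ p)
  inner-normal⇒spines (N ∷ σ) not-sub h here = inner-normal⇒spine N (box-not-lam N) (not-sub here) (h here)
  inner-normal⇒spines (N ∷ σ) not-sub h (there p) =
    inner-normal⇒spines σ (λ p → not-sub (there p)) (λ p → h (there p)) p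

proposition3p16 : ∀ {Γ : Ctx} {C : Ty} (M : Tm Γ C) → Normal M ⇔ Hat M
proposition3p16 M = mk⇔ (normal⇒hat M) hat⇒normal
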